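{- For every vertex $v$ of a circular interval graph $G$, $\deg_{G^2}(v) \le 4\omega(G)-4$.
   Context: A circular interval graph is a graph obtained as follows: take a circle $\Sigma$ and subsets $F_1,\dots,F_k\subseteq\Sigma$ each homeomorphic to $[0,1]$; the vertex set is a finite set of points of $\Sigma$, and two vertices are adjacent iff both lie in some $F_i$. The square $G^2$ has the same vertex set as $G$, with two distinct vertices adjacent iff their distance in $G$ is at most $2$; $\deg_{G^2}(v)$ is the degree of $v$ in $G^2$. $\omega$ is clique number. -}

module Defs where

open import Data.Nat using (ℕ; _∸_; _≤_; _≤?_; _<?_; _+_)
open import Data.Fin using (Fin; toℕ)
open import Data.Fin.Properties using (_≟_)
open import Data.Fin.Subset using (Subset; ∣_∣; _∈_)
open import Data.Vec using (tabulate)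
open import Data.List using (List; allFin)
open import Data.Bool.ListAction using (any)
open import Data.Bool using (Bool; if_then_else_; not; _∧_; _∨_; T)
open import Data.Product using (Σ; _×_)
open import Relation.Nullary.Decidable using (⌊_⌋)
open import Relation.Binary.PropositionalEquality using (_≡_; _≢_)

-- The n vertices are points of the circle Σ; we label them 0,1,…,n-1 in
-- their cyclic (say clockwise) order.  An arc F ⊆ Σ homeomorphic to [0,1]
-- contains exactly a cyclically contiguous block of vertices
--   start, start+1, …, start+len-1   (indices mod n),
-- and every such block arises from some arc.  So an arc is recorded by
-- its first vertex and the number of vertices it contains.

offset : ∀ {n} → Fin n → Fin n → ℕ
offset {n} s w =
  if ⌊ toℕ s ≤? toℕ w ⌋ then toℕ w ∸ toℕ s else (n ∸ toℕ s) + toℕ w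

record Arc (n : ℕ) : Set where
  constructor arc
  field
    start : Fin n
    len   : ℕ

inArc : ∀ {n} → Arc n → Fin n → Bool
inArc (arc s l) w = ⌊ offset s w <? l ⌋

record CircularIntervalGraph : Set where
  constructor cig
  field
    n    : ℕ
    arcs : List (Arc n)

open CircularIntervalGraph public

adj : (G : CircularIntervalGraph) → Fin (n G) → Fin (n G) → Bool
adj G u v = not ⌊ u ≟ v ⌋ ∧ any (λ F → inArc F u ∧ inArc F v) (arcs G)

adj² : (G : CircularIntervalGraph) → Fin (n G) → Fin (n G) → Bool
adj² G u v =
  not ⌊ u ≟ v ⌋ ∧ (adj G u v ∨ any (λ w → adj G u w ∧ adj G w v) (allFin (n G)))

deg² : (G : CircularIntervalGraph) → Fin (n G) → ℕ
deg² G v = ∣ tabulate (adj² G v) ∣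

IsClique : (G : CircularIntervalGraph) → Subset (n G) → Set
IsClique G S = ∀ u w → u ∈ S → w ∈ S → u ≢ w → T (adj G u w)

IsCliqueNumber : (G : CircularIntervalGraph) → ℕ → Set
IsCliqueNumber G k =
  Σ (Subset (n G)) (λ S → IsClique G S × ∣ S ∣ ≡ k)
  × (∀ S → IsClique G S → ∣ S ∣ ≤ k)

{-# OPTIONS --safe #-}
module Submission where

-- Measure positions clockwise from v, so that an arc F becomes the window of positions q
-- with (a + q) mod n < l, where a is the offset of v from the start of F.  If F contains
-- v and a neighbour w, it contains every position from v to w on one side, clockwise or
-- anticlockwise; so the neighbours of v split into two sides, each forming a clique with
-- v.  A vertex at distance two is adjacent to a neighbour on some side d.  Among those
-- attached to side d take the outermost, w, and its neighbour u on side d: the arc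
-- through u and w misses v, hence contains every position between u and w, and all
-- vertices at distance two attached to side d lie there (one closer to v than u would lie
-- in u's arc through v, so be adjacent to v).  With u they form a clique.  Each side thus
-- contributes two sets, each a clique minus a vertex and so of size at most ω - 1.

open import Defs
open import Data.Nat using (ℕ; _≤_; _<_; _*_; _∸_; _+_; zero; suc; NonZero; z≤n; s≤s; _≤?_; _<?_)
open import Data.Nat.Properties
open import Data.Nat.DivMod
  using (_%_; m%n<n; m<n⇒m%n≡m; [m+n]%n≡m%n; %-distribˡ-+; m≤n⇒[n∸m]%m≡n%m)
open import Data.Nat.Tactic.RingSolver using (solve-∀)
open import Data.Fin using (Fin; zero; suc; toℕ)
open import Data.Fin.Properties using (toℕ<n; nonZeroIndex; all?)
import Data.Fin.Properties as Fin
open import Data.Fin.Subset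
  using (Subset; inside; outside; _∈_; _∉_; _⊆_; _⊂_; _∪_; ⁅_⁆; ∣_∣; Empty)
open import Data.Fin.Subset.Properties
  using (p⊂q⇒∣p∣<∣q∣; p⊆q⇒∣p∣≤∣q∣; q⊆p∪q; x∈p∪q⁻; x∈p∪q⁺; x∈⁅x⁆; x∈⁅y⁆⇒x≡y)
open import Data.Vec using ([]; _∷_; tabulate)
open import Data.Vec.Properties using (lookup∘tabulate; []=⇒lookup; lookup⇒[]=)
open import Data.List using (allFin)
open import Data.List.Relation.Unary.Any using (Any; satisfied; any?)
  renaming (map to mapAny)
open import Data.List.Relation.Unary.Any.Properties using (any⁺; any⁻)
open import Data.List.Membership.Propositional using (find; lose) renaming (_∈_ to _∈ₗ_)
open import Data.Bool using (Bool; T; not)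
open import Data.Bool.Properties using (T-∧; T-∨; T-≡)
open import Data.Product using (∃; _×_; _,_; proj₁; proj₂; map₂)
open import Data.Sum using (_⊎_; inj₁; inj₂; [_,_]′)
import Data.Sum as Sum
open import Data.Empty using (⊥-elim)
open import Function using (_∘_; id)
open import Function.Bundles using (Equivalence)
open import Relation.Nullary using (¬_; Dec; yes; no; ¬?)
open import Relation.Nullary.Decidable
  using ( ⌊_⌋; T?; _×-dec_; _→-dec_
        ; toWitness; fromWitness; toWitnessFalse; fromWitnessFalse)
open import Relation.Unary using (Decidable)
open import Relation.Binary.Definitions using (Reflexive; Total; Transitive)
open import Relation.Binary.PropositionalEquality hiding ([_])

open Equivalence using (to; from)

%-wrap : ∀ {m n} .{{_ : NonZero n}} → n ≤ m → m < n + n → m % n ≡ m ∸ n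
%-wrap {m} {n} n≤m m<2n = begin
  m % n        ≡⟨ m≤n⇒[n∸m]%m≡n%m n≤m ⟨
  (m ∸ n) % n  ≡⟨ m<n⇒m%n≡m (m<n+o⇒m∸n<o m n m<2n) ⟩
  m ∸ n        ∎
  where open ≡-Reasoning

offset≡% : ∀ {n} .{{_ : NonZero n}} (s w : Fin n) → offset s w ≡ (n ∸ toℕ s + toℕ w) % n
offset≡% {n} s w with toℕ s ≤? toℕ w
... | yes s≤w = sym (begin
  (n ∸ toℕ s + toℕ w) % n  ≡⟨ cong (_% n) (+-∸-comm (toℕ w) s≤n) ⟨
  (n + toℕ w ∸ toℕ s) % n  ≡⟨ cong (_% n) (+-∸-assoc n s≤w) ⟩
  (n + (toℕ w ∸ toℕ s)) % n ≡⟨ cong (_% n) (+-comm n _) ⟩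
  (toℕ w ∸ toℕ s + n) % n  ≡⟨ [m+n]%n≡m%n _ n ⟩
  (toℕ w ∸ toℕ s) % n      ≡⟨ m<n⇒m%n≡m (≤-<-trans (m∸n≤m (toℕ w) (toℕ s)) (toℕ<n w)) ⟩
  toℕ w ∸ toℕ s            ∎)
  where
  open ≡-Reasoning
  s≤n = <⇒≤ (toℕ<n s)
... | no s≰w = sym (m<n⇒m%n≡m (begin-strict
  n ∸ toℕ s + toℕ w  <⟨ +-monoʳ-< (n ∸ toℕ s) (≰⇒> s≰w) ⟩
  n ∸ toℕ s + toℕ s  ≡⟨ m∸n+n≡m (<⇒≤ (toℕ<n s)) ⟩
  n                  ∎))
  where open ≤-Reasoning

offset<n : ∀ {n} .{{_ : NonZero n}} (s w : Fin n) → offset s w < n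
offset<n {n} s w = subst (_< n) (sym (offset≡% s w)) (m%n<n _ n)

offset-cocycle : ∀ {n} .{{_ : NonZero n}} (s v w : Fin n) →
  offset s w ≡ (offset s v + offset v w) % n
offset-cocycle {n} s v w = begin
  offset s w                                   ≡⟨ offset≡% s w ⟩
  (n ∸ s′ + w′) % n                            ≡⟨ [m+n]%n≡m%n _ n ⟨
  (n ∸ s′ + w′ + n) % n                        ≡⟨ cong (λ m → (n ∸ s′ + w′ + m) % n) (m+[n∸m]≡n v≤n) ⟨
  (n ∸ s′ + w′ + (v′ + (n ∸ v′))) % n          ≡⟨ cong (_% n) (regroup (n ∸ s′) w′ v′ (n ∸ v′)) ⟩
  (n ∸ s′ + v′ + (n ∸ v′ + w′)) % n            ≡⟨ %-distribˡ-+ (n ∸ s′ + v′) _ n ⟩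
  ((n ∸ s′ + v′) % n + (n ∸ v′ + w′) % n) % n
    ≡⟨ cong₂ (λ a b → (a + b) % n) (offset≡% s v) (offset≡% v w) ⟨
  (offset s v + offset v w) % n                ∎
  where
  open ≡-Reasoning
  s′ = toℕ s
  v′ = toℕ v
  w′ = toℕ w
  v≤n = <⇒≤ (toℕ<n v)
  regroup : ∀ a b c d → a + b + (c + d) ≡ a + c + (d + b)
  regroup = solve-∀

window∋0 : ∀ {n a l p} .{{_ : NonZero n}} → a < n → a < l → (a + p) % n < l →
  (∀ q → q ≤ p → (a + q) % n < l) ⊎ (∀ q → p ≤ q → q < n → (a + q) % n < l)
window∋0 {n} {a} {l} {p} a<n a<l a+p<l with a + p <? n
... | yes a+p<n = inj₁ λ q q≤p → begin-strict
  (a + q) % n  ≡⟨ m<n⇒m%n≡m (≤-<-trans (+-monoʳ-≤ a q≤p) a+p<n) ⟩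
  a + q        ≤⟨ +-monoʳ-≤ a q≤p ⟩
  a + p        ≡⟨ m<n⇒m%n≡m a+p<n ⟨
  (a + p) % n  <⟨ a+p<l ⟩
  l            ∎
  where open ≤-Reasoning
... | no a+p≮n = inj₂ λ q p≤q q<n →
  let n≤a+q = ≤-trans (≮⇒≥ a+p≮n) (+-monoʳ-≤ a p≤q)
      a+q<n+a = subst (a + q <_) (+-comm a n) (+-monoʳ-< a q<n)
  in begin-strict
  (a + q) % n  ≡⟨ %-wrap n≤a+q (+-mono-< a<n q<n) ⟩
  a + q ∸ n    <⟨ ∸-monoˡ-< a+q<n+a n≤a+q ⟩
  n + a ∸ n    ≡⟨ m+n∸m≡n n a ⟩
  a            <⟨ a<l ⟩
  l            ∎
  where open ≤-Reasoning

window∌0-convex : ∀ {n a l p q r} .{{_ : NonZero n}} → a < n → l ≤ a → r < n →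
  (a + p) % n < l → (a + r) % n < l → p ≤ q → q ≤ r → (a + q) % n < l
window∌0-convex {n} {a} {l} {p} {q} {r} a<n l≤a r<n a+p<l a+r<l p≤q q≤r = begin-strict
  (a + q) % n  ≡⟨ %-wrap n≤a+q (≤-<-trans (+-monoʳ-≤ a q≤r) a+r<2n) ⟩
  a + q ∸ n    ≤⟨ ∸-monoˡ-≤ n (+-monoʳ-≤ a q≤r) ⟩
  a + r ∸ n    ≡⟨ %-wrap n≤a+r a+r<2n ⟨
  (a + r) % n  <⟨ a+r<l ⟩
  l            ∎
  where
  open ≤-Reasoning
  a+r<2n = +-mono-< a<n r<n
  n≤a+p : n ≤ a + p
  n≤a+p = ≮⇒≥ λ a+p<n →
    <⇒≱ a+p<l (≤-trans l≤a (subst (a ≤_) (sym (m<n⇒m%n≡m a+p<n)) (m≤m+n a p)))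
  n≤a+q = ≤-trans n≤a+p (+-monoʳ-≤ a p≤q)
  n≤a+r = ≤-trans n≤a+q (+-monoʳ-≤ a q≤r)

greatest : ∀ {n} {P : Fin n → Set} {_≼_ : Fin n → Fin n → Set} →
  Decidable P → Reflexive _≼_ → Total _≼_ → Transitive _≼_ →
  (∀ i → ¬ P i) ⊎ ∃ λ i → P i × ∀ j → P j → j ≼ i
greatest {zero} P? ≼-refl ≼-total ≼-trans = inj₁ λ ()
greatest {suc n} P? ≼-refl ≼-total ≼-trans
  with P? zero | greatest (P? ∘ suc) ≼-refl (λ i j → ≼-total (suc i) (suc j)) ≼-trans
... | no ¬p₀ | inj₁ none = inj₁ λ { zero → ¬p₀ ; (suc i) → none i }
... | no ¬p₀ | inj₂ (i , pᵢ , max) =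
  inj₂ (suc i , pᵢ , λ { zero p₀ → ⊥-elim (¬p₀ p₀) ; (suc j) → max j })
... | yes p₀ | inj₁ none =
  inj₂ (zero , p₀ , λ { zero _ → ≼-refl ; (suc j) pⱼ → ⊥-elim (none j pⱼ) })
... | yes p₀ | inj₂ (i , pᵢ , max) with ≼-total zero (suc i)
...   | inj₁ 0≼i = inj₂ (suc i , pᵢ , λ { zero _ → 0≼i ; (suc j) → max j })
...   | inj₂ i≼0 = inj₂ (zero , p₀ , λ { zero _ → ≼-refl ; (suc j) pⱼ → ≼-trans (max j pⱼ) i≼0 })

∣p∪q∣≤∣p∣+∣q∣ : ∀ {n} (p q : Subset n) → ∣ p ∪ q ∣ ≤ ∣ p ∣ + ∣ q ∣
∣p∪q∣≤∣p∣+∣q∣ [] [] = z≤n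
∣p∪q∣≤∣p∣+∣q∣ (inside ∷ p) (inside ∷ q) =
  s≤s (≤-trans (∣p∪q∣≤∣p∣+∣q∣ p q) (+-monoʳ-≤ ∣ p ∣ (n≤1+n ∣ q ∣)))
∣p∪q∣≤∣p∣+∣q∣ (inside ∷ p) (outside ∷ q) = s≤s (∣p∪q∣≤∣p∣+∣q∣ p q)
∣p∪q∣≤∣p∣+∣q∣ (outside ∷ p) (inside ∷ q) =
  subst (suc ∣ p ∪ q ∣ ≤_) (sym (+-suc ∣ p ∣ ∣ q ∣)) (s≤s (∣p∪q∣≤∣p∣+∣q∣ p q))
∣p∪q∣≤∣p∣+∣q∣ (outside ∷ p) (outside ∷ q) = ∣p∪q∣≤∣p∣+∣q∣ p q

∈tabulate⁻ : ∀ {n} {f : Fin n → Bool} {x} → x ∈ tabulate f → T (f x)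
∈tabulate⁻ {f = f} {x} x∈ = from T-≡ (trans (sym (lookup∘tabulate f x)) ([]=⇒lookup x∈))

∈tabulate⁺ : ∀ {n} {f : Fin n → Bool} {x} → T (f x) → x ∈ tabulate f
∈tabulate⁺ {f = f} {x} fx = lookup⇒[]= x (tabulate f) (trans (lookup∘tabulate f x) (to T-≡ fx))

⟦_⟧ : ∀ {n} {P : Fin n → Set} → Decidable P → Subset n
⟦ P? ⟧ = tabulate (⌊_⌋ ∘ P?)

∈⟦⟧⁻ : ∀ {n} {P : Fin n → Set} (P? : Decidable P) {x} → x ∈ ⟦ P? ⟧ → P x
∈⟦⟧⁻ P? {x} = toWitness {a? = P? x} ∘ ∈tabulate⁻

∈⟦⟧⁺ : ∀ {n} {P : Fin n → Set} (P? : Decidable P) {x} → P x → x ∈ ⟦ P? ⟧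
∈⟦⟧⁺ P? {x} = ∈tabulate⁺ ∘ fromWitness {a? = P? x}

InArc : ∀ {n} → Arc n → Fin n → Set
InArc F w = T (inArc F w)

data Side : Set where
  forward backward : Side

module Adjacency (G : CircularIntervalGraph) where

  ShareArc : Fin (n G) → Fin (n G) → Set
  ShareArc u w = Any (λ F → InArc F u × InArc F w) (arcs G)

  adj⇒ : ∀ {u w} → T (adj G u w) → u ≢ w × ShareArc u w
  adj⇒ {u} {w} h with to (T-∧ {not ⌊ u Fin.≟ w ⌋}) h
  ... | u≢w , shared =
    toWitnessFalse u≢w , mapAny (λ {F} → to (T-∧ {inArc F u})) (any⁻ _ (arcs G) shared)

  adj⇐ : ∀ {u w} → u ≢ w → ShareArc u w → T (adj G u w)
  adj⇐ {u} {w} u≢w shared = from (T-∧ {not ⌊ u Fin.≟ w ⌋})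
    (fromWitnessFalse u≢w , any⁺ _ (mapAny (λ {F} → from (T-∧ {inArc F u})) shared))

  adj²⇒ : ∀ {u w} → T (adj² G u w) →
    u ≢ w × (T (adj G u w) ⊎ ∃ λ x → T (adj G u x) × T (adj G x w))
  adj²⇒ {u} {w} h with to (T-∧ {not ⌊ u Fin.≟ w ⌋}) h
  ... | u≢w , near-or-via with to (T-∨ {adj G u w}) near-or-via
  ...   | inj₁ uw  = toWitnessFalse u≢w , inj₁ uw
  ...   | inj₂ via with satisfied (any⁻ _ (allFin (n G)) via)
  ...     | x , ux∧xw = toWitnessFalse u≢w , inj₂ (x , to (T-∧ {adj G u x}) ux∧xw)

  arc-clique : ∀ {F S} → F ∈ₗ arcs G → (∀ {x} → x ∈ S → InArc F x) → IsClique G S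
  arc-clique F∈G S⊆F u w u∈S w∈S u≢w = adj⇐ u≢w (lose F∈G (S⊆F u∈S , S⊆F w∈S))

module CliqueBound (G : CircularIntervalGraph) {ω : ℕ} (ω-max : IsCliqueNumber G ω) where

  ∣S∣<ω : ∀ {S x} → x ∉ S → IsClique G (⁅ x ⁆ ∪ S) → ∣ S ∣ < ω
  ∣S∣<ω {S} {x} x∉S clique = <-≤-trans (p⊂q⇒∣p∣<∣q∣ S⊂) (proj₂ ω-max _ clique)
    where
    S⊂ : S ⊂ ⁅ x ⁆ ∪ S
    S⊂ = q⊆p∪q ⁅ x ⁆ S , x , x∈p∪q⁺ (inj₁ (x∈⁅x⁆ x)) , x∉S

  ∣∅∣<ω : ∀ {S} → Fin (n G) → Empty S → ∣ S ∣ < ω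
  ∣∅∣<ω {S} x empty = ∣S∣<ω (λ x∈S → empty (x , x∈S)) clique
    where
    only-x : ∀ {u} → u ∈ ⁅ x ⁆ ∪ S → u ≡ x
    only-x u∈ = [ x∈⁅y⁆⇒x≡y x , (λ u∈S → ⊥-elim (empty (_ , u∈S))) ]′ (x∈p∪q⁻ ⁅ x ⁆ S u∈)
    clique : IsClique G (⁅ x ⁆ ∪ S)
    clique u w u∈ w∈ u≢w = ⊥-elim (u≢w (trans (only-x u∈) (sym (only-x w∈))))

module Around (G : CircularIntervalGraph) (v : Fin (n G)) where

  open Adjacency G

  private
    N = n G
    instance
      N≢0 : NonZero N
      N≢0 = nonZeroIndex v

  pos : Fin N → ℕ
  pos = offset v

  _≼[_]_ : Fin N → Side → Fin N → Set
  u ≼[ forward  ] w = pos u ≤ pos w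
  u ≼[ backward ] w = pos w ≤ pos u

  ≼-refl : ∀ d {w} → w ≼[ d ] w
  ≼-refl forward  = ≤-refl
  ≼-refl backward = ≤-refl

  ≼-total : ∀ d → Total (_≼[ d ]_)
  ≼-total forward  u w = ≤-total (pos u) (pos w)
  ≼-total backward u w = ≤-total (pos w) (pos u)

  ≼-trans : ∀ d → Transitive (_≼[ d ]_)
  ≼-trans forward  u≼w w≼x = ≤-trans u≼w w≼x
  ≼-trans backward u≼w w≼x = ≤-trans w≼x u≼w

  _≼[_]?_ : ∀ u d w → Dec (u ≼[ d ] w)
  u ≼[ forward  ]? w = pos u ≤? pos w
  u ≼[ backward ]? w = pos w ≤? pos u

  ∈arc⇒window : ∀ {s l y} → InArc (arc s l) y → (offset s v + pos y) % N < l
  ∈arc⇒window {s} {l} {y} y∈F = subst (_< l) (offset-cocycle s v y) (toWitness y∈F)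

  window⇒∈arc : ∀ {s l y} → (offset s v + pos y) % N < l → InArc (arc s l) y
  window⇒∈arc {s} {l} {y} lt = fromWitness (subst (_< l) (sym (offset-cocycle s v y)) lt)

  arc-through-v : ∀ {F x} → InArc F v → InArc F x → ∃ λ d → ∀ y → y ≼[ d ] x → InArc F y
  arc-through-v {arc s l} v∈F x∈F
    with window∋0 (offset<n s v) (toWitness v∈F) (∈arc⇒window {s} {l} x∈F)
  ... | inj₁ below = forward  , λ y y≼x → window⇒∈arc {s} {l} (below (pos y) y≼x)
  ... | inj₂ above = backward , λ y y≼x → window⇒∈arc {s} {l} (above (pos y) y≼x (offset<n v y))

  arc-avoiding-v : ∀ {F x y z} d → ¬ InArc F v → InArc F x → InArc F z →
    x ≼[ d ] y → y ≼[ d ] z → InArc F y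
  arc-avoiding-v {arc s l} {z = z} forward v∉F x∈F z∈F x≤y y≤z = window⇒∈arc {s} {l}
    (window∌0-convex (offset<n s v) (≮⇒≥ (v∉F ∘ fromWitness)) (offset<n v z)
      (∈arc⇒window {s} {l} x∈F) (∈arc⇒window {s} {l} z∈F) x≤y y≤z)
  arc-avoiding-v {F} {x} {y} {z} backward v∉F x∈F z∈F x≼y y≼z =
    arc-avoiding-v {F} {z} {y} {x} forward v∉F z∈F x∈F y≼z x≼y

  Covers : Side → Fin N → Arc N → Set
  Covers d w F = InArc F v × ∀ u → u ≼[ d ] w → InArc F u

  Near : Side → Fin N → Set
  Near d w = w ≢ v × Any (Covers d w) (arcs G)

  near? : ∀ d → Decidable (Near d)
  near? d w = ¬? (w Fin.≟ v) ×-dec any? covers? (arcs G)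
    where
    covers? : Decidable (Covers d w)
    covers? F = T? (inArc F v) ×-dec all? (λ u → u ≼[ d ]? w →-dec T? (inArc F u))

  Far : Side → Fin N → Set
  Far d w = w ≢ v × ¬ T (adj G v w) × ∃ λ u → Near d u × T (adj G u w)

  far? : ∀ d → Decidable (Far d)
  far? d w = ¬? (w Fin.≟ v) ×-dec ¬? (T? (adj G v w)) ×-dec
    Fin.any? (λ u → near? d u ×-dec T? (adj G u w))

  Half : Side → Subset N
  Half d = ⟦ near? d ⟧ ∪ ⟦ far? d ⟧

  near-adj : ∀ {d w x y} → Near d w → x ≡ v ⊎ x ≼[ d ] w → y ≡ v ⊎ y ≼[ d ] w →
    x ≢ y → T (adj G x y)
  near-adj {d} {w} (_ , arcs) x-below y-below x≢y =
    adj⇐ x≢y (mapAny (λ {F} covers → in-F F covers x-below , in-F F covers y-below) arcs)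
    where
    in-F : ∀ F {x} → Covers d w F → x ≡ v ⊎ x ≼[ d ] w → InArc F x
    in-F F (v∈F , _)  (inj₁ refl) = v∈F
    in-F F (_   , F⊇) (inj₂ x≼w)  = F⊇ _ x≼w

  near⇒adj : ∀ {d w} → Near d w → T (adj G v w)
  near⇒adj {d} r = near-adj r (inj₁ refl) (inj₂ (≼-refl d)) (proj₁ r ∘ sym)

  adj⇒near : ∀ {w} → T (adj G v w) → ∃ λ d → Near d w
  adj⇒near vw with adj⇒ vw
  ... | v≢w , shared with find shared
  ... | F , F∈G , v∈F , w∈F with arc-through-v {F} v∈F w∈F
  ... | d , F⊇ = d , v≢w ∘ sym , lose F∈G (v∈F , F⊇)

  adj²⇒half : ∀ {w} → T (adj² G v w) → ∃ λ d → Near d w ⊎ Far d w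
  adj²⇒half {w} vw = by-cases (T? (adj G v w)) (adj²⇒ vw)
    where
    by-cases : Dec (T (adj G v w)) →
      v ≢ w × (T (adj G v w) ⊎ ∃ λ u → T (adj G v u) × T (adj G u w)) →
      ∃ λ d → Near d w ⊎ Far d w
    by-cases (yes v~w) _                          = map₂ inj₁ (adj⇒near v~w)
    by-cases (no v≁w)  (_   , inj₁ v~w)           = ⊥-elim (v≁w v~w)
    by-cases (no v≁w)  (v≢w , inj₂ (u , vu , uw)) =
      map₂ (λ near-u → inj₂ (v≢w ∘ sym , v≁w , u , near-u , uw)) (adj⇒near vu)

  ∈Half : ∀ d {w} → Near d w ⊎ Far d w → w ∈ Half d
  ∈Half d = x∈p∪q⁺ ∘ Sum.map (∈⟦⟧⁺ (near? d)) (∈⟦⟧⁺ (far? d))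

  N²⊆Half : tabulate (adj² G v) ⊆ Half forward ∪ Half backward
  N²⊆Half {w} w∈ = in-some-half (adj²⇒half (∈tabulate⁻ w∈))
    where
    in-some-half : (∃ λ d → Near d w ⊎ Far d w) → w ∈ Half forward ∪ Half backward
    in-some-half (forward  , r) = x∈p∪q⁺ (inj₁ (∈Half forward r))
    in-some-half (backward , r) = x∈p∪q⁺ (inj₂ (∈Half backward r))

  module _ {ω : ℕ} (ω-max : IsCliqueNumber G ω) where

    open CliqueBound G ω-max

    ∣Near∣<ω : ∀ d → ∣ ⟦ near? d ⟧ ∣ < ω
    ∣Near∣<ω d = ∣S∣<ω (λ v∈N → proj₁ (∈⟦⟧⁻ (near? d) v∈N) refl) clique
      where
      clique : IsClique G (⁅ v ⁆ ∪ ⟦ near? d ⟧)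
      clique x y x∈ y∈ = pair (member x∈) (member y∈)
        where
        member : ∀ {x} → x ∈ ⁅ v ⁆ ∪ ⟦ near? d ⟧ → x ≡ v ⊎ Near d x
        member x∈ = Sum.map (x∈⁅y⁆⇒x≡y v) (∈⟦⟧⁻ (near? d)) (x∈p∪q⁻ _ _ x∈)
        pair : x ≡ v ⊎ Near d x → y ≡ v ⊎ Near d y → x ≢ y → T (adj G x y)
        pair (inj₁ refl) (inj₁ refl) x≢y = ⊥-elim (x≢y refl)
        pair (inj₁ refl) (inj₂ ny)       = near-adj ny (inj₁ refl) (inj₂ (≼-refl d))
        pair (inj₂ nx)   (inj₁ refl)     = near-adj nx (inj₂ (≼-refl d)) (inj₁ refl)
        pair (inj₂ nx)   (inj₂ ny)       = [ (λ x≼y → near-adj ny (inj₂ x≼y) (inj₂ (≼-refl d)))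
                                           , (λ y≼x → near-adj nx (inj₂ (≼-refl d)) (inj₂ y≼x))
                                           ]′ (≼-total d x y)

    far-in-arc : ∀ {d w} → Far d w → (∀ x → Far d x → x ≼[ d ] w) →
      ∃ λ u → Near d u × ∃ λ F → F ∈ₗ arcs G × InArc F u × (∀ {x} → Far d x → InArc F x)
    far-in-arc {d} {w} (w≢v , v≁w , u , near-u , uw) w-max with find (proj₂ (adj⇒ uw))
    ... | F , F∈G , u∈F , w∈F =
      u , near-u , F , F∈G , u∈F ,
      λ {x} far-x → arc-avoiding-v {F} {u} {x} {w} d v∉F u∈F w∈F (u≼ far-x) (w-max x far-x)
      where
      v∉F : ¬ InArc F v
      v∉F v∈F = v≁w (adj⇐ (w≢v ∘ sym) (lose F∈G (v∈F , w∈F)))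
      u≼ : ∀ {x} → Far d x → u ≼[ d ] x
      u≼ {x} (x≢v , v≁x , _) =
        [ (λ x≼u → ⊥-elim (v≁x (near-adj near-u (inj₁ refl) (inj₂ x≼u) (x≢v ∘ sym)))) , id ]′
        (≼-total d x u)

    ∣Far∣<ω : ∀ d → ∣ ⟦ far? d ⟧ ∣ < ω
    ∣Far∣<ω d with greatest (far? d) (≼-refl d) (≼-total d) (≼-trans d)
    ... | inj₁ none = ∣∅∣<ω v (λ (x , x∈) → none x (∈⟦⟧⁻ (far? d) x∈))
    ... | inj₂ (w , far-w , w-max) with far-in-arc far-w w-max
    ...   | u , near-u , F , F∈G , u∈F , F⊇Far = ∣S∣<ω u∉Far (arc-clique F∈G ⊆F)
      where
      u∉Far : u ∉ ⟦ far? d ⟧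
      u∉Far u∈ = proj₁ (proj₂ (∈⟦⟧⁻ (far? d) u∈)) (near⇒adj near-u)
      ⊆F : ∀ {x} → x ∈ ⁅ u ⁆ ∪ ⟦ far? d ⟧ → InArc F x
      ⊆F x∈ with x∈p∪q⁻ ⁅ u ⁆ ⟦ far? d ⟧ x∈
      ... | inj₁ x∈⁅u⁆ rewrite x∈⁅y⁆⇒x≡y u x∈⁅u⁆ = u∈F
      ... | inj₂ x∈Far = F⊇Far (∈⟦⟧⁻ (far? d) x∈Far)

    ∣Half∣≤ : ∀ d → ∣ Half d ∣ ≤ 2 * (ω ∸ 1)
    ∣Half∣≤ d = begin
      ∣ Half d ∣                              ≤⟨ ∣p∪q∣≤∣p∣+∣q∣ ⟦ near? d ⟧ ⟦ far? d ⟧ ⟩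
      ∣ ⟦ near? d ⟧ ∣ + ∣ ⟦ far? d ⟧ ∣       ≤⟨ +-mono-≤ (<⇒≤∸1 (∣Near∣<ω d)) (<⇒≤∸1 (∣Far∣<ω d)) ⟩
      (ω ∸ 1) + (ω ∸ 1)                       ≡⟨ cong ((ω ∸ 1) +_) (+-identityʳ (ω ∸ 1)) ⟨
      2 * (ω ∸ 1)                             ∎
      where
      open ≤-Reasoning
      <⇒≤∸1 : ∀ {m k} → m < k → m ≤ k ∸ 1
      <⇒≤∸1 (s≤s m≤k) = m≤k

lemma3p3 : (G : CircularIntervalGraph) (v : Fin (n G)) (ω : ℕ) →
    IsCliqueNumber G ω → deg² G v ≤ 4 * ω ∸ 4
lemma3p3 G v ω ω-max = begin
  deg² G v                                    ≤⟨ p⊆q⇒∣p∣≤∣q∣ N²⊆Half ⟩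
  ∣ Half forward ∪ Half backward ∣            ≤⟨ ∣p∪q∣≤∣p∣+∣q∣ (Half forward) (Half backward) ⟩
  ∣ Half forward ∣ + ∣ Half backward ∣        ≤⟨ +-mono-≤ (∣Half∣≤ ω-max forward) (∣Half∣≤ ω-max backward) ⟩
  2 * (ω ∸ 1) + 2 * (ω ∸ 1)                   ≡⟨ *-distribʳ-+ (ω ∸ 1) 2 2 ⟨
  4 * (ω ∸ 1)                                 ≡⟨ *-distribˡ-∸ 4 ω 1 ⟩
  4 * ω ∸ 4                                   ∎
  where
  open ≤-Reasoning
  open Around G v
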